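{- For every $\delta > 0$ there exists $c(\delta) > 0$ such that the following holds. Let $r > s \ge 1$ be integers and set $\varepsilon = (r-s)/r$. Then $$R_{r,s}(k) \ge \exp\big( c(\delta)\, \varepsilon r \big)$$ for every integer $k \ge (1+\delta)/\varepsilon + 1$.
   Context: For positive integers $r > s \ge 1$ and $k$, the set-colouring Ramsey number $R_{r,s}(k)$ is the least $n \in \mathbb{N}$ such that every colouring $\chi \colon E(K_n) \to \binom{[r]}{s}$ (each edge of $K_n$ is assigned a set of exactly $s$ colours from $[r]$) contains a monochromatic clique of size $k$, i.e. a $k$-set $S$ of vertices and a colour $i$ with $i \in \chi(e)$ for all $e \in \binom{S}{2}$.
   Formalization: The parameter δ ranges over the positive rationals, and the constant c(δ) is taken in the positive rationals. -}

module Defs where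

open import Data.Nat using (ℕ)
open import Data.Fin using (Fin)
open import Data.Fin.Subset using (Subset; _∈_; ∣_∣)
open import Data.Product using (Σ; _×_; ∃-syntax)
open import Relation.Binary.PropositionalEquality using (_≡_; _≢_)

-- A colouring χ : E(K_n) → ([r] choose s), represented as a symmetric
-- function on pairs of distinct vertices (the diagonal is irrelevant).
IsSetColouring : (r s n : ℕ) → (Fin n → Fin n → Subset r) → Set
IsSetColouring r s n χ =
  (∀ u v → χ u v ≡ χ v u) × (∀ u v → u ≢ v → ∣ χ u v ∣ ≡ s)

HasMonoClique : (r n k : ℕ) → (Fin n → Fin n → Subset r) → Set
HasMonoClique r n k χ =
  ∃[ S ] ∃[ i ] (∣ S ∣ ≡ k ×
    (∀ u v → u ∈ S → v ∈ S → u ≢ v → i ∈ χ u v))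

-- n has the Ramsey property: every colouring has a monochromatic k-clique.
-- R_{r,s}(k) is the least such n.
RamseyProp : (r s k n : ℕ) → Set
RamseyProp r s k n =
  (χ : Fin n → Fin n → Subset r) → IsSetColouring r s n χ → HasMonoClique r n k χ

{-# OPTIONS --safe #-}
-- Write K = k - 1 and t = r - s. If C is a set of words in [K]^r any two of which agree in
-- at most t positions, colour the edge between two codewords by s positions where they
-- differ: a clique monochromatic in colour i has pairwise different letters at position i,
-- so it has at most K vertices, and R_{r,s}(k) > |C|.
-- Such a C is built greedily. Weighting a pair of words by (m+1)^(agreements) m^(disagreements),
-- the total weight around any word is (Km+1)^r, while a word agreeing with x in more than t
-- positions has weight at least (m+1)^(t+1) m^(r-t-1); hence |C| ≥ ((m+1)/m)^(t+1) (Km/(Km+1))^r.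
-- If (Q+1) r ≤ K Q t, Bernoulli's inequality gives (Km/(Km+1))^((Q+1) r) ≥ ((m-1)/m)^(Q t), so
-- |C|^(Q+1) ≥ ρ^t with ρ = ((m+1)/m)^(Q+1) ((m-1)/m)^Q, and for m = 2Q Bernoulli again gives
-- ρ^(8Q²) ≥ 2.
module Submission where

open import Defs
open import Data.Nat
  using (ℕ; suc; _+_; _*_; _∸_; _^_; _≤_; _<_; zero; pred; z≤n; s≤s; s≤s⁻¹; NonZero)
open import Data.Product using (∃-syntax; _×_; _,_)

open import Data.Bool using (true; false; if_then_else_)
open import Data.Fin using (Fin; zero; suc; inject≤) renaming (_<_ to _<ᶠ_)
open import Data.Fin.Properties using (_≟_)
import Data.Fin.Properties as Fin
open import Data.Fin.Subset using (Subset; inside; outside; ∣_∣; _∈_; _⊆_; ∁; ⊥; ⊤; _-_)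
open import Data.Fin.Subset.Properties
  using (∣⊥∣≡0; ⊆-min; ∈⊤; ∣⊤∣≡n; ∣∁p∣≡n∸∣p∣; x∈p⇒∣p-x∣<∣p∣; x∈p∧x∉q⇒x∈p─q; x∈⁅y⁆⇒x≡y)
open import Data.List
  using (List; []; _∷_; _++_; map; length; tabulate; allFin; cartesianProductWith; filter)
import Data.List as List
open import Data.List.Properties
  using (map-++; map-∘; map-cong; length-++; length-map; length-tabulate; map-tabulate; length-filter)
open import Data.List.Membership.Propositional.Properties using (∈-lookup)
open import Data.List.Relation.Unary.All as All using (All; []; _∷_)
import Data.List.Relation.Unary.All.Properties as Allₚ
open import Data.List.Relation.Unary.AllPairs as AllPairs using (AllPairs; []; _∷_)
open import Data.Nat.ListAction using (sum)
open import Data.Nat.ListAction.Properties using (sum-++)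
open import Data.Nat.Properties hiding (_≟_)
open import Algebra.Properties.CommutativeSemigroup *-commutativeSemigroup
  using (interchange; xy∙z≈xz∙y; xy∙z≈x∙zy; x∙yz≈y∙xz; x∙yz≈xz∙y)
open import Data.Nat.Tactic.RingSolver using (solve-∀)
open import Data.Vec using (Vec; []; _∷_; zipWith; lookup; here; there)
open import Function using (_∘_; id)
import Relation.Binary.Definitions as Binary
open import Relation.Binary.Definitions using (tri<; tri≈; tri>)
open import Relation.Binary.PropositionalEquality
open import Relation.Nullary using (yes; no; ¬_; ¬?; does; contradiction)
import Relation.Unary as Unary

-- Fractions compared by cross-multiplication

^-distribʳ-* : ∀ m n o → (m * n) ^ o ≡ m ^ o * n ^ o
^-distribʳ-* m n zero    = refl
^-distribʳ-* m n (suc o) = begin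
  m * n * (m * n) ^ o    ≡⟨ cong (m * n *_) (^-distribʳ-* m n o) ⟩
  m * n * (m ^ o * n ^ o)  ≡⟨ interchange m n (m ^ o) (n ^ o) ⟩
  m * m ^ o * (n * n ^ o)  ∎
  where open ≡-Reasoning

-- A record rather than a synonym for a * d ≤ c * b, so that a, b, c and d can be inferred.
infix 4 _/_≤_/_
record _/_≤_/_ (a b c d : ℕ) : Set where
  constructor cross
  field uncross : a * d ≤ c * b
open _/_≤_/_ public

/≤/-refl : ∀ a b → a / b ≤ a / b
/≤/-refl a b = cross ≤-refl

module _ {a b c d : ℕ} where
  open ≤-Reasoning

  /≤/-trans : ∀ {e f} .{{_ : NonZero d}} → a / b ≤ c / d → c / d ≤ e / f → a / b ≤ e / f
  /≤/-trans {e} {f} (cross ad≤cb) (cross cf≤ed) = cross (*-cancelʳ-≤ (a * f) (e * b) d (begin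
    a * f * d  ≡⟨ xy∙z≈xz∙y a f d ⟩
    a * d * f  ≤⟨ *-monoˡ-≤ f ad≤cb ⟩
    c * b * f  ≡⟨ xy∙z≈xz∙y c b f ⟩
    c * f * b  ≤⟨ *-monoˡ-≤ b cf≤ed ⟩
    e * d * b  ≡⟨ xy∙z≈xz∙y e d b ⟩
    e * b * d  ∎))

  /≤/-invert : a / b ≤ c / d → d / c ≤ b / a
  /≤/-invert (cross ad≤cb) = cross (begin
    d * a  ≡⟨ *-comm d a ⟩
    a * d  ≤⟨ ad≤cb ⟩
    c * b  ≡⟨ *-comm c b ⟩
    b * c  ∎)

  /≤/-* : ∀ {e f g h} → a / b ≤ c / d → e / f ≤ g / h → a * e / b * f ≤ c * g / d * h
  /≤/-* {e} {f} {g} {h} (cross ad≤cb) (cross eh≤gf) = cross (begin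
    a * e * (d * h)  ≡⟨ interchange a e d h ⟩
    a * d * (e * h)  ≤⟨ *-mono-≤ ad≤cb eh≤gf ⟩
    c * b * (g * f)  ≡⟨ interchange c b g f ⟩
    c * g * (b * f)  ∎)

  /≤/-*ˡ : ∀ e → a / b ≤ c / d → e * a / b ≤ e * c / d
  /≤/-*ˡ e (cross ad≤cb) = cross (begin
    e * a * d    ≡⟨ *-assoc e a d ⟩
    e * (a * d)  ≤⟨ *-monoʳ-≤ e ad≤cb ⟩
    e * (c * b)  ≡⟨ *-assoc e c b ⟨
    e * c * b    ∎)

  /≤/-expand : ∀ e → a / b ≤ c / d → a / b ≤ e * c / e * d
  /≤/-expand e (cross ad≤cb) = cross (begin
    a * (e * d)  ≡⟨ x∙yz≈y∙xz a e d ⟩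
    e * (a * d)  ≤⟨ *-monoʳ-≤ e ad≤cb ⟩
    e * (c * b)  ≡⟨ *-assoc e c b ⟨
    e * c * b    ∎)

  /≤/-^ : a / b ≤ c / d → ∀ n → a ^ n / b ^ n ≤ c ^ n / d ^ n
  /≤/-^ (cross ad≤cb) n = cross (begin
    a ^ n * d ^ n  ≡⟨ ^-distribʳ-* a d n ⟨
    (a * d) ^ n    ≤⟨ ^-monoˡ-≤ n ad≤cb ⟩
    (c * b) ^ n    ≡⟨ ^-distribʳ-* c b n ⟩
    c ^ n * b ^ n  ∎)

  /≤/-transpose : ∀ {e} → a / b ≤ c * e / d → a * d / b * e ≤ c / 1
  /≤/-transpose {e} (cross ad≤ceb) = cross (begin
    a * d * 1    ≡⟨ *-identityʳ (a * d) ⟩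
    a * d        ≤⟨ ad≤ceb ⟩
    c * e * b    ≡⟨ xy∙z≈x∙zy c e b ⟩
    c * (b * e)  ∎)

/≤/-^-monoʳ : ∀ {a b i j} → b ≤ a → i ≤ j → a ^ i / b ^ i ≤ a ^ j / b ^ j
/≤/-^-monoʳ {a} {b} {i} b≤a i≤j with d , refl ← m≤n⇒∃[o]m+o≡n i≤j = cross (begin
  a ^ i * b ^ (i + d)      ≡⟨ cong (a ^ i *_) (^-distribˡ-+-* b i d) ⟩
  a ^ i * (b ^ i * b ^ d)  ≤⟨ *-monoʳ-≤ (a ^ i) (*-monoʳ-≤ (b ^ i) (^-monoˡ-≤ d b≤a)) ⟩
  a ^ i * (b ^ i * a ^ d)  ≡⟨ x∙yz≈xz∙y (a ^ i) (b ^ i) (a ^ d) ⟩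
  a ^ i * a ^ d * b ^ i    ≡⟨ cong (_* b ^ i) (^-distribˡ-+-* a i d) ⟨
  a ^ (i + d) * b ^ i      ∎)
  where
  open ≤-Reasoning

-- Bernoulli's inequality

bernoulli : ∀ L .{{_ : NonZero L}} j → L + j / L ≤ suc L ^ j / L ^ j
bernoulli L zero    = cross (≤-reflexive (*-identityʳ (L + 0)))
bernoulli L (suc j) = /≤/-trans {{m*n≢0 L L}} increment (/≤/-* (/≤/-refl (suc L) L) (bernoulli L j))
  where
  increment : L + suc j / L ≤ suc L * (L + j) / L * L
  increment = cross (≤-trans (m≤m+n _ (j * L)) (≤-reflexive (identity L j)))
    where
    identity : ∀ L j → (L + suc j) * (L * L) + j * L ≡ suc L * (L + j) * L
    identity = solve-∀

bernoulli-∸ : ∀ n j → suc n ∸ j / suc n ≤ n ^ j / suc n ^ j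
bernoulli-∸ n zero    = cross (≤-reflexive (*-comm (suc n) 1))
bernoulli-∸ n (suc j) = /≤/-trans decrement (/≤/-* (/≤/-refl n (suc n)) (bernoulli-∸ n j))
  where
  open ≤-Reasoning
  [n∸j]/n≤[1+n∸j]/[1+n] : (n ∸ j) * suc n ≤ (suc n ∸ j) * n
  [n∸j]/n≤[1+n∸j]/[1+n] with j ≤? n
  ... | yes j≤n = begin
    (n ∸ j) * suc n      ≡⟨ *-suc (n ∸ j) n ⟩
    n ∸ j + (n ∸ j) * n  ≤⟨ +-monoˡ-≤ ((n ∸ j) * n) (m∸n≤m n j) ⟩
    n + (n ∸ j) * n      ≡⟨ cong (_* n) (+-∸-assoc 1 j≤n) ⟨
    (suc n ∸ j) * n      ∎
  ... | no j≰n = begin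
    (n ∸ j) * suc n  ≡⟨ cong (_* suc n) (m≤n⇒m∸n≡0 (<⇒≤ (≰⇒> j≰n))) ⟩
    0                ≤⟨ z≤n ⟩
    (suc n ∸ j) * n  ∎
  decrement : n ∸ j / suc n ≤ n * (suc n ∸ j) / suc n * suc n
  decrement = cross (begin
    (n ∸ j) * (suc n * suc n)  ≡⟨ *-assoc (n ∸ j) (suc n) (suc n) ⟨
    (n ∸ j) * suc n * suc n    ≤⟨ *-monoˡ-≤ (suc n) [n∸j]/n≤[1+n∸j]/[1+n] ⟩
    (suc n ∸ j) * n * suc n    ≡⟨ cong (_* suc n) (*-comm (suc n ∸ j) n) ⟩
    n * (suc n ∸ j) * suc n    ∎)

bernoulli-block : ∀ k m → suc (k * suc m) ^ k / (k * suc m) ^ k ≤ suc m / m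
bernoulli-block k m = /≤/-trans inverted (cross (≤-trans (m≤m+n _ 1) (≤-reflexive (identity k m))))
  where
  identity : ∀ k m → suc (k * suc m) * m + 1 ≡ suc m * suc (k * m)
  identity = solve-∀
  remaining : suc (k * suc m) ∸ k ≡ suc (k * m)
  remaining = begin
    suc (k * suc m) ∸ k  ≡⟨ cong (λ x → suc x ∸ k) (*-suc k m) ⟩
    suc (k + k * m) ∸ k  ≡⟨ cong (_∸ k) (+-suc k (k * m)) ⟨
    k + suc (k * m) ∸ k  ≡⟨ m+n∸m≡n k (suc (k * m)) ⟩
    suc (k * m)          ∎
    where open ≡-Reasoning
  inverted : suc (k * suc m) ^ k / (k * suc m) ^ k ≤ suc (k * suc m) / suc (k * m)
  inverted = subst (λ d → suc (k * suc m) ^ k / (k * suc m) ^ k ≤ suc (k * suc m) / d) remaining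
    (/≤/-invert (bernoulli-∸ (k * suc m) k))

-- Sums over lists and greedy packing

private variable
  A B C : Set

sum-map-*ˡ : ∀ c (f : A → ℕ) xs → sum (map (λ x → c * f x) xs) ≡ c * sum (map f xs)
sum-map-*ˡ c f []       = sym (*-zeroʳ c)
sum-map-*ˡ c f (x ∷ xs) = begin
  c * f x + sum (map (λ x → c * f x) xs)  ≡⟨ cong (c * f x +_) (sum-map-*ˡ c f xs) ⟩
  c * f x + c * sum (map f xs)            ≡⟨ *-distribˡ-+ c (f x) _ ⟨
  c * (f x + sum (map f xs))              ∎
  where open ≡-Reasoning

sum-tabulate-const : ∀ n c → sum (tabulate {n = n} (λ _ → c)) ≡ n * c
sum-tabulate-const zero    c = refl
sum-tabulate-const (suc n) c = cong (c +_) (sum-tabulate-const n c)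

length-cartesianProductWith : ∀ (f : A → B → C) xs ys →
  length (cartesianProductWith f xs ys) ≡ length xs * length ys
length-cartesianProductWith f []       ys = refl
length-cartesianProductWith f (x ∷ xs) ys = begin
  length (map (f x) ys ++ cartesianProductWith f xs ys)  ≡⟨ length-++ (map (f x) ys) ⟩
  length (map (f x) ys) + length (cartesianProductWith f xs ys)
    ≡⟨ cong₂ _+_ (length-map (f x) ys) (length-cartesianProductWith f xs ys) ⟩
  length ys + length xs * length ys  ∎
  where open ≡-Reasoning

sum-map-cartesianProductWith : ∀ (f : A → B → C) (h : C → ℕ) (g : A → ℕ) (k : B → ℕ) →
  (∀ x y → h (f x y) ≡ g x * k y) →
  ∀ xs ys → sum (map h (cartesianProductWith f xs ys)) ≡ sum (map g xs) * sum (map k ys)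
sum-map-cartesianProductWith f h g k h-mult []       ys = refl
sum-map-cartesianProductWith f h g k h-mult (x ∷ xs) ys = begin
  sum (map h (map (f x) ys ++ cartesianProductWith f xs ys))
    ≡⟨ cong sum (map-++ h (map (f x) ys) _) ⟩
  sum (map h (map (f x) ys) ++ map h (cartesianProductWith f xs ys))
    ≡⟨ sum-++ (map h (map (f x) ys)) _ ⟩
  sum (map h (map (f x) ys)) + sum (map h (cartesianProductWith f xs ys))
    ≡⟨ cong₂ _+_ row (sum-map-cartesianProductWith f h g k h-mult xs ys) ⟩
  g x * sum (map k ys) + sum (map g xs) * sum (map k ys)
    ≡⟨ *-distribʳ-+ (sum (map k ys)) (g x) _ ⟨
  (g x + sum (map g xs)) * sum (map k ys)  ∎
  where
  open ≡-Reasoning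
  row : sum (map h (map (f x) ys)) ≡ g x * sum (map k ys)
  row = begin
    sum (map h (map (f x) ys))       ≡⟨ cong sum (map-∘ ys) ⟨
    sum (map (h ∘ f x) ys)           ≡⟨ cong sum (map-cong (h-mult x) ys) ⟩
    sum (map (λ y → g x * k y) ys)   ≡⟨ sum-map-*ˡ (g x) k ys ⟩
    g x * sum (map k ys)             ∎

module _ {A : Set} {P : A → Set} (P? : Unary.Decidable P) where

  length-filter-split : ∀ xs → length xs ≡ length (filter P? xs) + length (filter (¬? ∘ P?) xs)
  length-filter-split []       = refl
  length-filter-split (x ∷ xs) with P? x
  ... | yes _ = cong suc (length-filter-split xs)
  ... | no  _ = trans (cong suc (length-filter-split xs)) (sym (+-suc _ _))

  sum-map-filter-≤ : ∀ (g : A → ℕ) xs → sum (map g (filter P? xs)) ≤ sum (map g xs)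
  sum-map-filter-≤ g []       = z≤n
  sum-map-filter-≤ g (x ∷ xs) with does (P? x)
  ... | true  = +-monoʳ-≤ (g x) (sum-map-filter-≤ g xs)
  ... | false = ≤-trans (sum-map-filter-≤ g xs) (m≤n+m _ (g x))

  length-filter-*-≤-sum : ∀ {b} (g : A → ℕ) → (∀ {x} → P x → b ≤ g x) →
    ∀ xs → length (filter P? xs) * b ≤ sum (map g xs)
  length-filter-*-≤-sum g P⇒b≤g []       = z≤n
  length-filter-*-≤-sum g P⇒b≤g (x ∷ xs) with P? x
  ... | yes Px = +-mono-≤ (P⇒b≤g Px) (length-filter-*-≤-sum g P⇒b≤g xs)
  ... | no  _  = ≤-trans (length-filter-*-≤-sum g P⇒b≤g xs) (m≤n+m _ (g x))

module GreedyPacking {A : Set} {Close : A → A → Set} (close? : Binary.Decidable Close) where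

  -- The first argument is fuel, to be at least the length of the list.
  greedy : ℕ → List A → List A
  greedy zero    _        = []
  greedy (suc f) []       = []
  greedy (suc f) (x ∷ xs) = x ∷ greedy f (filter (¬? ∘ close? x) xs)

  greedy⁺ : ∀ {P : A → Set} f {xs} → All P xs → All P (greedy f xs)
  greedy⁺ zero    _          = []
  greedy⁺ (suc f) []         = []
  greedy⁺ (suc f) (px ∷ pxs) = px ∷ greedy⁺ f (Allₚ.filter⁺ _ pxs)

  greedy-separated : ∀ f xs → AllPairs (λ x y → ¬ Close x y) (greedy f xs)
  greedy-separated zero    _        = []
  greedy-separated (suc f) []       = []
  greedy-separated (suc f) (x ∷ xs) =
    greedy⁺ f (Allₚ.all-filter (¬? ∘ close? x) xs) ∷ greedy-separated f _

  module _ (close-refl : ∀ x → Close x x) (w : A → A → ℕ) {b W : ℕ}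
           (close⇒b≤w : ∀ {x y} → Close x y → b ≤ w x y) where

    greedy-size : ∀ f xs → length xs ≤ f → (∀ z → sum (map (w z) xs) ≤ W) →
                  length xs * b ≤ length (greedy f xs) * W
    greedy-size f       []       _      _     = z≤n
    greedy-size (suc f) (x ∷ xs) xs≤1+f bound = begin
      suc (length xs) * b
        ≡⟨ cong (λ l → suc l * b) (length-filter-split (close? x) xs) ⟩
      suc (length near + length far) * b       ≡⟨ *-distribʳ-+ b (suc (length near)) (length far) ⟩
      suc (length near) * b + length far * b   ≤⟨ +-mono-≤ near-size far-size ⟩
      W + length (greedy f far) * W            ∎
      where
      open ≤-Reasoning
      near far : List A
      near = filter (close? x) xs
      far  = filter (¬? ∘ close? x) xs
      near-size : suc (length near) * b ≤ W
      near-size = ≤-trans (+-mono-≤ (close⇒b≤w (close-refl x))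
                                    (length-filter-*-≤-sum (close? x) (w x) close⇒b≤w xs))
                          (bound x)
      far-size : length far * b ≤ length (greedy f far) * W
      far-size = greedy-size f far (≤-trans (length-filter _ xs) (s≤s⁻¹ xs≤1+f))
        (λ z → ≤-trans (sum-map-filter-≤ _ (w z) xs) (≤-trans (m≤n+m _ (w z x)) (bound z)))

-- Codes

agreementSet : ∀ {k r} → Vec (Fin k) r → Vec (Fin k) r → Subset r
agreementSet = zipWith (λ a b → does (a ≟ b))

agreements : ∀ {k r} → Vec (Fin k) r → Vec (Fin k) r → ℕ
agreements x y = ∣ agreementSet x y ∣

agreements-refl : ∀ {k r} (x : Vec (Fin k) r) → agreements x x ≡ r
agreements-refl []      = refl
agreements-refl (a ∷ x) with a ≟ a
... | yes _   = cong suc (agreements-refl x)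
... | no  a≢a = contradiction refl a≢a

agreementSet-comm : ∀ {k r} (x y : Vec (Fin k) r) → agreementSet x y ≡ agreementSet y x
agreementSet-comm []      []      = refl
agreementSet-comm (a ∷ x) (b ∷ y) = cong₂ _∷_ (does-sym a b) (agreementSet-comm x y)
  where
  does-sym : ∀ {k} (a b : Fin k) → does (a ≟ b) ≡ does (b ≟ a)
  does-sym a b with a ≟ b | b ≟ a
  ... | yes _   | yes _   = refl
  ... | no  _   | no  _   = refl
  ... | yes a≡b | no  b≢a = contradiction (sym a≡b) b≢a
  ... | no  a≢b | yes b≡a = contradiction (sym b≡a) a≢b

∈∁agreementSet⇒≢ : ∀ {k r} (x y : Vec (Fin k) r) i →
                   i ∈ ∁ (agreementSet x y) → lookup x i ≢ lookup y i
∈∁agreementSet⇒≢ (a ∷ x) (b ∷ y) zero    i∈ with a ≟ b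
∈∁agreementSet⇒≢ (a ∷ x) (b ∷ y) zero    () | yes _
... | no a≢b = a≢b
∈∁agreementSet⇒≢ (a ∷ x) (b ∷ y) (suc i) (there i∈) = ∈∁agreementSet⇒≢ x y i i∈

letterWeight : ∀ {k} → ℕ → Fin k → Fin k → ℕ
letterWeight m a b = if does (a ≟ b) then suc m else m

weight : ∀ {k r} → ℕ → Vec (Fin k) r → Vec (Fin k) r → ℕ
weight m []      []      = 1
weight m (a ∷ x) (b ∷ y) = letterWeight m a b * weight m x y

weight-lower : ∀ m {k r} (x y : Vec (Fin k) r) j → j ≤ agreements x y →
               suc m ^ j / m ^ j ≤ weight m x y / m ^ r
weight-lower m []      []      zero    _ = /≤/-refl 1 1
weight-lower m (a ∷ x) (b ∷ y) j       j≤ with a ≟ b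
weight-lower m (a ∷ x) (b ∷ y) zero    _       | yes _ =
  /≤/-* one≤ (weight-lower m x y zero z≤n)
  where
  one≤ : 1 / 1 ≤ suc m / m
  one≤ = cross (subst₂ _≤_ (sym (*-identityˡ m)) (sym (*-identityʳ (suc m))) (n≤1+n m))
weight-lower m (a ∷ x) (b ∷ y) (suc j) (s≤s j≤) | yes _ =
  /≤/-* (/≤/-refl (suc m) m) (weight-lower m x y j j≤)
... | no _ = /≤/-expand m (weight-lower m x y j j≤)

allWords : ∀ k r → List (Vec (Fin k) r)
allWords k zero    = [] ∷ []
allWords k (suc r) = cartesianProductWith _∷_ (allFin k) (allWords k r)

length-allWords : ∀ k r → length (allWords k r) ≡ k ^ r
length-allWords k zero    = refl
length-allWords k (suc r) = trans (length-cartesianProductWith _∷_ (allFin k) (allWords k r))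
  (cong₂ _*_ (length-tabulate {n = k} id) (length-allWords k r))

sum-letterWeight : ∀ m {k} (a : Fin k) → sum (map (letterWeight m a) (allFin k)) ≡ suc (k * m)
sum-letterWeight m a = trans (cong sum (map-tabulate id (letterWeight m a))) (sum-tabulate m a)
  where
  sum-tabulate : ∀ m {k} (a : Fin k) → sum (tabulate (letterWeight m a)) ≡ suc (k * m)
  sum-tabulate m {suc k} zero    = cong (suc m +_) (sum-tabulate-const k m)
  sum-tabulate m {suc k} (suc a) = trans (cong (m +_) (sum-tabulate m a)) (+-suc m (k * m))

sum-weight : ∀ m {k r} (x : Vec (Fin k) r) →
             sum (map (weight m x) (allWords k r)) ≡ suc (k * m) ^ r
sum-weight m         []      = refl
sum-weight m {k} {suc r} (a ∷ x) = begin
  sum (map (weight m (a ∷ x)) (cartesianProductWith _∷_ (allFin k) (allWords k r)))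
    ≡⟨ sum-map-cartesianProductWith _∷_ (weight m (a ∷ x)) (letterWeight m a) (weight m x)
         (λ _ _ → refl) (allFin k) (allWords k r) ⟩
  sum (map (letterWeight m a) (allFin k)) * sum (map (weight m x) (allWords k r))
    ≡⟨ cong₂ _*_ (sum-letterWeight m a) (sum-weight m x) ⟩
  suc (k * m) * suc (k * m) ^ r  ∎
  where open ≡-Reasoning

separatedCode : ∀ k m {r t} → t < r → ∃[ C ] (AllPairs (λ x y → agreements x y ≤ t) C ×
  suc m ^ suc t / m ^ suc t ≤ length C * suc (k * m) ^ r / (k * m) ^ r)
separatedCode k m {r} {t} t<r =
  code , AllPairs.map ≮⇒≥ (greedy-separated (length words) words) , cross (begin
    suc m ^ suc t * (k * m) ^ r                  ≡⟨ cong (suc m ^ suc t *_) (^-distribʳ-* k m r) ⟩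
    suc m ^ suc t * (k ^ r * m ^ r)              ≡⟨ x∙yz≈y∙xz (suc m ^ suc t) (k ^ r) (m ^ r) ⟩
    k ^ r * (suc m ^ suc t * m ^ r)              ≡⟨ cong (_* _) (length-allWords k r) ⟨
    length words * (suc m ^ suc t * m ^ r)       ≤⟨ size ⟩
    length code * (m ^ suc t * suc (k * m) ^ r)  ≡⟨ x∙yz≈xz∙y (length code) (m ^ suc t) _ ⟩
    length code * suc (k * m) ^ r * m ^ suc t    ∎)
  where
  open ≤-Reasoning
  open GreedyPacking (λ x y → t <? agreements x y)
  words code : List (Vec (Fin k) r)
  words = allWords k r
  code  = greedy (length words) words
  -- Scaled by m ^ (t + 1), the weight of a close pair is bounded below without subtraction.
  w : Vec (Fin k) r → Vec (Fin k) r → ℕ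
  w x y = m ^ suc t * weight m x y
  close-refl : ∀ x → t < agreements x x
  close-refl x = subst (t <_) (sym (agreements-refl x)) t<r
  close⇒b≤w : ∀ {x y} → t < agreements x y → suc m ^ suc t * m ^ r ≤ w x y
  close⇒b≤w {x} {y} t<a = ≤-trans (uncross (weight-lower m x y (suc t) t<a))
                                   (≤-reflexive (*-comm (weight m x y) (m ^ suc t)))
  sum-w : ∀ z → sum (map (w z) words) ≡ m ^ suc t * suc (k * m) ^ r
  sum-w z = trans (sum-map-*ˡ (m ^ suc t) (weight m z) words) (cong (m ^ suc t *_) (sum-weight m z))
  size : length words * (suc m ^ suc t * m ^ r) ≤ length code * (m ^ suc t * suc (k * m) ^ r)
  size = greedy-size close-refl w (λ {x} {y} → close⇒b≤w {x} {y}) (length words) words ≤-refl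
                     (λ z → ≤-reflexive (sum-w z))

-- Colourings from codes

firstElems : ∀ {n} → ℕ → Subset n → Subset n
firstElems zero    p             = ⊥
firstElems (suc d) []            = []
firstElems (suc d) (outside ∷ p) = outside ∷ firstElems (suc d) p
firstElems (suc d) (inside  ∷ p) = inside  ∷ firstElems d p

∣firstElems∣ : ∀ {n} d (p : Subset n) → d ≤ ∣ p ∣ → ∣ firstElems d p ∣ ≡ d
∣firstElems∣ {n} zero p _ = ∣⊥∣≡0 n
∣firstElems∣ (suc d) (outside ∷ p) d<∣p∣     = ∣firstElems∣ (suc d) p d<∣p∣
∣firstElems∣ (suc d) (inside  ∷ p) (s≤s d≤) = cong suc (∣firstElems∣ d p d≤)

firstElems⊆ : ∀ {n} d (p : Subset n) → firstElems d p ⊆ p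
firstElems⊆ zero    p             = ⊆-min p
firstElems⊆ (suc d) (outside ∷ p) (there i∈) = there (firstElems⊆ (suc d) p i∈)
firstElems⊆ (suc d) (inside  ∷ p) here       = here
firstElems⊆ (suc d) (inside  ∷ p) (there i∈) = there (firstElems⊆ d p i∈)

injectiveOn⇒∣p∣≤∣q∣ : ∀ {n k} (p : Subset n) (q : Subset k) (f : Fin n → Fin k) →
  (∀ {u} → u ∈ p → f u ∈ q) → (∀ {u v} → u ∈ p → v ∈ p → u ≢ v → f u ≢ f v) → ∣ p ∣ ≤ ∣ q ∣
injectiveOn⇒∣p∣≤∣q∣ []            q f _    _   = z≤n
injectiveOn⇒∣p∣≤∣q∣ (outside ∷ p) q f into inj =
  injectiveOn⇒∣p∣≤∣q∣ p q (f ∘ suc) (into ∘ there)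
    (λ u∈p v∈p u≢v → inj (there u∈p) (there v∈p) (u≢v ∘ Fin.suc-injective))
injectiveOn⇒∣p∣≤∣q∣ (inside ∷ p) q f into inj =
  ≤-trans (s≤s rest) (x∈p⇒∣p-x∣<∣p∣ (into here))
  where
  rest : ∣ p ∣ ≤ ∣ q - f zero ∣
  rest = injectiveOn⇒∣p∣≤∣q∣ p (q - f zero) (f ∘ suc)
    (λ u∈p → x∈p∧x∉q⇒x∈p─q (into (there u∈p))
                            (inj (there u∈p) here (λ ()) ∘ x∈⁅y⁆⇒x≡y (f zero)))
    (λ u∈p v∈p u≢v → inj (there u∈p) (there v∈p) (u≢v ∘ Fin.suc-injective))

module _ {k r s t n} (word : Fin n → Vec (Fin k) r)
         (separated : ∀ {u v} → u ≢ v → agreements (word u) (word v) ≤ t)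
         (s+t≡r : s + t ≡ r) where

  differenceColouring : Fin n → Fin n → Subset r
  differenceColouring u v = firstElems s (∁ (agreementSet (word u) (word v)))

  differenceColouring-isSetColouring : IsSetColouring r s n differenceColouring
  differenceColouring-isSetColouring =
    (λ u v → cong (firstElems s ∘ ∁) (agreementSet-comm (word u) (word v))) ,
    (λ u v u≢v → ∣firstElems∣ s _ (begin
      s                                    ≡⟨ m+n∸n≡m s t ⟨
      s + t ∸ t                            ≡⟨ cong (_∸ t) s+t≡r ⟩
      r ∸ t                                ≤⟨ ∸-monoʳ-≤ r (separated u≢v) ⟩
      r ∸ agreements (word u) (word v)     ≡⟨ ∣∁p∣≡n∸∣p∣ (agreementSet (word u) (word v)) ⟨
      ∣ ∁ (agreementSet (word u) (word v)) ∣ ∎))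
    where open ≤-Reasoning

  differenceColouring-noMonoClique : ¬ HasMonoClique r n (suc k) differenceColouring
  differenceColouring-noMonoClique (S , i , ∣S∣≡1+k , mono) =
    1+n≰n (subst (_≤ k) ∣S∣≡1+k (subst (∣ S ∣ ≤_) (∣⊤∣≡n k) letters-distinct))
    where
    letters-distinct : ∣ S ∣ ≤ ∣ ⊤ {k} ∣
    letters-distinct = injectiveOn⇒∣p∣≤∣q∣ S ⊤ (λ u → lookup (word u) i) (λ _ → ∈⊤)
      (λ {u} {v} u∈S v∈S u≢v → ∈∁agreementSet⇒≢ (word u) (word v) i
        (firstElems⊆ s _ (mono u v u∈S v∈S u≢v)))

AllPairs-lookup : ∀ {A : Set} {R : A → A → Set} {xs} → AllPairs R xs →
  ∀ {i j} → i <ᶠ j → R (List.lookup xs i) (List.lookup xs j)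
AllPairs-lookup (px ∷ _)   {zero}  {suc j} _         = All.lookup px (∈-lookup j)
AllPairs-lookup (_  ∷ pxs) {suc i} {suc j} (s≤s i<j) = AllPairs-lookup pxs i<j

separatedCode⇒length<n : ∀ {k r s t n} → s + t ≡ r → (C : List (Vec (Fin k) r)) →
  AllPairs (λ x y → agreements x y ≤ t) C → RamseyProp r s (suc k) n → length C < n
separatedCode⇒length<n {k} {r} {s} {t} {n} s+t≡r C sep ramsey with length C <? n
... | yes C<n = C<n
... | no  C≮n = contradiction (ramsey (differenceColouring word separated s+t≡r)
                                      (differenceColouring-isSetColouring word separated s+t≡r))
                              (differenceColouring-noMonoClique word separated s+t≡r)
  where
  n≤C : n ≤ length C
  n≤C = ≮⇒≥ C≮n
  word : Fin n → Vec (Fin k) r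
  word u = List.lookup C (inject≤ u n≤C)
  separated : ∀ {u v} → u ≢ v → agreements (word u) (word v) ≤ t
  separated {u} {v} u≢v with Fin.<-cmp (inject≤ u n≤C) (inject≤ v n≤C)
  ... | tri< u<v _ _ = AllPairs-lookup sep u<v
  ... | tri≈ _ u≡v _ = contradiction (Fin.inject≤-injective n≤C n≤C u v u≡v) u≢v
  ... | tri> _ _ v<u = subst (_≤ t) (cong ∣_∣ (agreementSet-comm (word v) (word u)))
                             (AllPairs-lookup sep v<u)

-- From the size of a code to the Ramsey bound

^-swap : ∀ a i j → (a ^ i) ^ j ≡ (a ^ j) ^ i
^-swap a i j = trans (^-*-assoc a i j) (trans (cong (a ^_) (*-comm i j)) (sym (^-*-assoc a j i)))

regroup : ∀ a b Q t → (a * (b * a) ^ Q) ^ t ≡ (a ^ t) ^ suc Q * b ^ (Q * t)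
regroup a b Q t = begin
  (a * (b * a) ^ Q) ^ t          ≡⟨ cong (λ x → (a * x) ^ t) (^-distribʳ-* b a Q) ⟩
  (a * (b ^ Q * a ^ Q)) ^ t      ≡⟨ cong (_^ t) (x∙yz≈y∙xz a (b ^ Q) (a ^ Q)) ⟩
  (b ^ Q * a ^ suc Q) ^ t        ≡⟨ ^-distribʳ-* (b ^ Q) (a ^ suc Q) t ⟩
  (b ^ Q) ^ t * (a ^ suc Q) ^ t  ≡⟨ *-comm ((b ^ Q) ^ t) _ ⟩
  (a ^ suc Q) ^ t * (b ^ Q) ^ t  ≡⟨ cong₂ _*_ (^-swap a (suc Q) t) (^-*-assoc b Q t) ⟩
  (a ^ t) ^ suc Q * b ^ (Q * t)  ∎
  where open ≡-Reasoning

code-size-exponential : ∀ {k m₀ N r t Q} .{{_ : NonZero k}} → suc Q * r ≤ k * (Q * t) →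
  suc (suc m₀) ^ suc t / suc m₀ ^ suc t ≤ N * suc (k * suc m₀) ^ r / (k * suc m₀) ^ r →
  (suc (suc m₀) * (m₀ * suc (suc m₀)) ^ Q) ^ t / (suc m₀ * (suc m₀ * suc m₀) ^ Q) ^ t ≤ N ^ suc Q / 1
code-size-exponential {k} {m₀} {N} {r} {t} {Q} density code =
  subst₂ (λ a b → a / b ≤ N ^ suc Q / 1) (sym (regroup (suc m) m₀ Q t)) (sym (regroup m m Q t))
    (/≤/-transpose (/≤/-trans {{m^n≢0 (X ^ r) (suc Q) {{m^n≢0 X r {{X≢0}}}}}}
                              code-ratio^[1+Q] (/≤/-*ˡ (N ^ suc Q) blocks)))
  where
  m X : ℕ
  m = suc m₀
  X = k * m
  X≢0 : NonZero X
  X≢0 = m*n≢0 k m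
  code-ratio : suc m ^ t / m ^ t ≤ N * suc X ^ r / X ^ r
  code-ratio = /≤/-trans {{m^n≢0 m (suc t)}} (/≤/-^-monoʳ (n≤1+n m) (n≤1+n t)) code
  code-ratio^[1+Q] : (suc m ^ t) ^ suc Q / (m ^ t) ^ suc Q ≤
                     N ^ suc Q * (suc X ^ r) ^ suc Q / (X ^ r) ^ suc Q
  code-ratio^[1+Q] = subst (λ c → (suc m ^ t) ^ suc Q / (m ^ t) ^ suc Q ≤ c / (X ^ r) ^ suc Q)
    (^-distribʳ-* N (suc X ^ r) (suc Q)) (/≤/-^ code-ratio (suc Q))
  blocks : (suc X ^ r) ^ suc Q / (X ^ r) ^ suc Q ≤ m ^ (Q * t) / m₀ ^ (Q * t)
  blocks = /≤/-trans {{m^n≢0 X (k * (Q * t)) {{X≢0}}}} more-blocks bernoulli-blocks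
    where
    more-blocks : (suc X ^ r) ^ suc Q / (X ^ r) ^ suc Q ≤ suc X ^ (k * (Q * t)) / X ^ (k * (Q * t))
    more-blocks = subst₂ (λ a b → a / b ≤ suc X ^ (k * (Q * t)) / X ^ (k * (Q * t)))
      (sym (^-*-assoc (suc X) r (suc Q))) (sym (^-*-assoc X r (suc Q)))
      (/≤/-^-monoʳ (n≤1+n X) (≤-trans (≤-reflexive (*-comm r (suc Q))) density))
    bernoulli-blocks : suc X ^ (k * (Q * t)) / X ^ (k * (Q * t)) ≤ m ^ (Q * t) / m₀ ^ (Q * t)
    bernoulli-blocks = subst₂ (λ a b → a / b ≤ m ^ (Q * t) / m₀ ^ (Q * t))
      (^-*-assoc (suc X) k (Q * t)) (^-*-assoc X k (Q * t)) (/≤/-^ (bernoulli-block k m₀) (Q * t))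

2^t≤N^[e*L] : ∀ {v u t e N L} .{{_ : NonZero u}} →
  2 / 1 ≤ v ^ L / u ^ L → v ^ t / u ^ t ≤ N ^ e / 1 → 2 ^ t ≤ N ^ (e * L)
2^t≤N^[e*L] {v} {u} {t} {e} {N} {L} doubling bound = begin
  2 ^ t                  ≡⟨ *-identityʳ (2 ^ t) ⟨
  2 ^ t * 1              ≡⟨ cong (2 ^ t *_) (^-zeroˡ L) ⟨
  2 ^ t * 1 ^ L          ≤⟨ uncross (/≤/-trans {{m^n≢0 (u ^ t) L {{m^n≢0 u t}}}}
                                               doubling^t (/≤/-^ bound L)) ⟩
  (N ^ e) ^ L * 1 ^ t    ≡⟨ cong₂ _*_ (^-*-assoc N e L) (^-zeroˡ t) ⟩
  N ^ (e * L) * 1        ≡⟨ *-identityʳ (N ^ (e * L)) ⟩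
  N ^ (e * L)            ∎
  where
  open ≤-Reasoning
  doubling^t : 2 ^ t / 1 ^ t ≤ (v ^ t) ^ L / (u ^ t) ^ L
  doubling^t = subst₂ (λ a b → 2 ^ t / 1 ^ t ≤ a / b) (^-swap v L t) (^-swap u L t) (/≤/-^ doubling t)

-- With m = 2Q and L = 8Q², (1 + 1/m)(1 - Q/m²) ≥ 1 + 1/L, so the ratio
-- v/u = ((m+1)/m)^(Q+1) ((m-1)/m)^Q satisfies (v/u)^L ≥ (1 + 1/L)^L ≥ 2.
module ParameterChoice (q : ℕ) where
  Q m₀ m m²-1 L : ℕ
  Q    = suc q
  m₀   = suc (q + q)
  m    = suc m₀
  m²-1 = m₀ * suc m
  L    = 8 * (Q * Q)

  v u : ℕ
  v = suc m * m²-1 ^ Q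
  u = m * (m * m) ^ Q

  u≢0 : NonZero u
  u≢0 = m*n≢0 m ((m * m) ^ Q) {{_}} {{m^n≢0 (m * m) Q}}

  doubling : 2 / 1 ≤ v ^ L / u ^ L
  doubling = /≤/-trans {{m^n≢0 L L}} two (/≤/-^ ρ≥1+1/L L)
    where
    two : 2 / 1 ≤ suc L ^ L / L ^ L
    two = /≤/-trans (cross (≤-reflexive (twice L))) (bernoulli L L)
      where
      twice : ∀ L → 2 * L ≡ (L + L) * 1
      twice = solve-∀
    suc[m²-1]≡m*m : suc m²-1 ≡ m * m
    suc[m²-1]≡m*m = sq q
      where
      sq : ∀ q → suc (suc (q + q) * suc (suc (suc (q + q)))) ≡ suc (suc (q + q)) * suc (suc (q + q))
      sq = solve-∀
    m²∸Q≡Q[4q+3] : suc m²-1 ∸ Q ≡ Q * (4 * q + 3)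
    m²∸Q≡Q[4q+3] = trans (cong (_∸ Q) (split q)) (m+n∸m≡n Q (Q * (4 * q + 3)))
      where
      split : ∀ q → suc (suc (q + q) * suc (suc (suc (q + q)))) ≡ suc q + suc q * (4 * q + 3)
      split = solve-∀
    1+1/L≤[1+1/m][1-Q/m²] : suc L / L ≤ suc m * (suc m²-1 ∸ Q) / m * suc m²-1
    1+1/L≤[1+1/m][1-Q/m²] = cross (begin
      suc L * (m * suc m²-1)                         ≤⟨ m≤m+n _ (16 * (Q * Q * Q) * q) ⟩
      suc L * (m * suc m²-1) + 16 * (Q * Q * Q) * q  ≡⟨ poly q ⟩
      suc m * (Q * (4 * q + 3)) * L                  ≡⟨ cong (λ x → suc m * x * L) m²∸Q≡Q[4q+3] ⟨
      suc m * (suc m²-1 ∸ Q) * L                     ∎)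
      where
      open ≤-Reasoning
      poly : ∀ q → suc (8 * (suc q * suc q))
                       * (suc (suc (q + q)) * suc (suc (q + q) * suc (suc (suc (q + q)))))
                     + 16 * (suc q * suc q * suc q) * q
                   ≡ suc (suc (suc (q + q))) * (suc q * (4 * q + 3)) * (8 * (suc q * suc q))
      poly = solve-∀
    ρ≥1+1/L : suc L / L ≤ v / u
    ρ≥1+1/L = subst (λ d → suc L / L ≤ v / m * d ^ Q) suc[m²-1]≡m*m
      (/≤/-trans 1+1/L≤[1+1/m][1-Q/m²] (/≤/-* (/≤/-refl (suc m) m) (bernoulli-∸ m²-1 Q)))

  ramsey-lower-bound : ∀ {k r s t n} .{{_ : NonZero k}} → s + t ≡ r → t < r →
                       suc Q * r ≤ k * (Q * t) → RamseyProp r s (suc k) n → 2 ^ t ≤ n ^ (suc Q * L)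
  ramsey-lower-bound {k} {r} {s} {t} {n} s+t≡r t<r density ramsey
    with code , separated , size ← separatedCode k m t<r = begin
    2 ^ t                      ≤⟨ 2^t≤N^[e*L] {v} {u} {t} {suc Q} {length code} {L} {{u≢0}} doubling
                                    (code-size-exponential {k} {m₀} {length code} {r} {t} {Q} density size) ⟩
    length code ^ (suc Q * L)  ≤⟨ ^-monoˡ-≤ (suc Q * L)
                                    (<⇒≤ (separatedCode⇒length<n s+t≡r code separated ramsey)) ⟩
    n ^ (suc Q * L)            ∎
    where open ≤-Reasoning

theorem4p2 : ∀ (p q : ℕ) → ∃[ a ] ∃[ b ] (∀ (r s k n : ℕ) → 1 ≤ s → s < r →
    (suc q + suc p) * r ≤ (k ∸ 1) * suc q * (r ∸ s) →
    RamseyProp r s k n → 2 ^ (suc a * (r ∸ s)) ≤ n ^ suc b)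
-- Only δ ≥ 1/(q + 1) is used, so the constants depend on q alone.
theorem4p2 p q = 0 , pred (suc Q * L) , bound
  where
  open ParameterChoice q
  density⇒ : ∀ {r k t} → (suc q + suc p) * r ≤ k * suc q * t → suc Q * r ≤ k * (Q * t)
  density⇒ {r} {k} {t} density =
    ≤-trans (*-monoˡ-≤ r (≤-trans (≤-reflexive (+-comm 1 Q)) (+-monoʳ-≤ Q (s≤s z≤n))))
            (≤-trans density (≤-reflexive (*-assoc k Q t)))
  bound : ∀ r s k n → 1 ≤ s → s < r → (suc q + suc p) * r ≤ (k ∸ 1) * suc q * (r ∸ s) →
          RamseyProp r s k n → 2 ^ (1 * (r ∸ s)) ≤ n ^ (suc Q * L)
  bound zero    _       _             _ _  ()  _  _
  bound (suc r) zero    _             _ () _   _  _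
  bound (suc r) (suc s) zero          _ _  _   () _
  bound (suc r) (suc s) (suc zero)    _ _  _   () _
  bound (suc r) (suc s) (suc (suc k)) n _  s<r density ramsey =
    subst (λ e → 2 ^ e ≤ n ^ (suc Q * L)) (sym (+-identityʳ (r ∸ s)))
      (ramsey-lower-bound {suc k} {suc r} {suc s} {r ∸ s}
        (m+[n∸m]≡n (<⇒≤ s<r)) (s≤s (m∸n≤m r s)) (density⇒ {suc r} {suc k} {r ∸ s} density) ramsey)
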